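{- Let $n\ge 2$ and $\pi=[\pi_1,\dots,\pi_{n-1}]\in B_{n-1}$. For $i\in\{0,\dots,n-1\}$ let $\pi_{n,i}$ (resp. $\pi_{ -n,i}$) in $B_n$ be obtained by inserting $n$ (resp. $-n$) into the one-line notation of $\pi$ immediately after $\pi_i$ (immediately before $\pi_1$ if $i=0$). Then \begin{enumerate} \item $\sum_{i=0}^{n-1}q^{inv(\pi_{n,i})}=[n]_q\,q^{inv(\pi)}$; \item $\sum_{i=0}^{n-1}q^{inv(\pi_{ -n,i})}=q^n[n]_q\,q^{inv(\pi)}$, \end{enumerate} where $q$ is an indeterminate and $[n]_q=\frac{1-q^n}{1-q}$.
   Context: For $m\ge1$, let $e_1,\dots,e_m$ be the standard basis of $\mathbb{R}^m$. The hyperoctahedral group $B_m$ is the group of signed permutations: linear maps $w$ of $\mathbb{R}^m$ with $w(e_k)=\varepsilon_k e_{\beta(k)}$, $\beta\in S_m$, $\varepsilon_k\in\{\pm1\}$; one-line notation $w=[w(1),\dots,w(m)]$ with $w(k)=\varepsilon_k\beta(k)$. Positive roots of $B_m$: $\Psi^+=\{e_l:1\le l\le m\}\cup\{e_j-e_i,\ e_j+e_i:1\le i<j\le m\}$, $\Psi^-=-\Psi^+$. For $i=1,\dots,m$ put $\Psi_i=\{e_{m+1-i}\}\cup\{e_{m+1-i}-e_j,\ e_{m+1-i}+e_j:1\le j<m+1-i\}$, $inv_i(w)=|w(\Psi_i)\cap\Psi^-|$ and $inv(w)=\sum_{i=1}^m inv_i(w)$ (computed in the group $B_m$ to which $w$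 belongs). -}

module Defs where

open import Level using (Level)
open import Data.Nat as ℕ using (ℕ; zero; suc; _∸_; _≡ᵇ_; _<ᵇ_)
open import Data.Integer as ℤ using (ℤ; +_; -[1+_]; ∣_∣)
open import Data.Bool using (if_then_else_)
open import Data.List using (List; []; _∷_; map; upTo; length; zipWith; replicate; foldr; take; drop; _++_; filter; concatMap)
open import Data.Nat.ListAction using (sum)
import Data.List.Properties as LP
open import Data.List.Relation.Binary.Permutation.Propositional using (_↭_)
open import Relation.Nullary using (Dec)
open import Algebra.Bundles using (CommutativeSemiring)

-- Vectors of ℤ^m are lists of length m; coordinates are 1-based.

range1 : ℕ → List ℕ
range1 m = map suc (upTo m)

basis : ℕ → ℕ → List ℤ
basis m l = map (λ k → if k ≡ᵇ l then + 1 else + 0) (range1 m)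

_⊕_ : List ℤ → List ℤ → List ℤ
_⊕_ = zipWith ℤ._+_

_⊖_ : List ℤ → List ℤ → List ℤ
_⊖_ = zipWith ℤ._-_

scale : ℤ → List ℤ → List ℤ
scale a = map (a ℤ.*_)

-- Signed permutations in one-line notation: w = [w(1), ..., w(m)] ∈ B_m
-- with m = length w.

IsSignedPerm : List ℤ → Set
IsSignedPerm w = map ∣_∣ w ↭ range1 (length w)

sgn : ℤ → ℤ
sgn (+ zero)  = + 0
sgn (+ suc _) = + 1
sgn -[1+ _ ]  = -[1+ 0 ]

-- the linear map of ℤ^m determined by w(e_k) = ε_k e_{β(k)}, where
-- w(k) = ε_k β(k); applied to v = Σ_k v_k e_k.
act : List ℤ → List ℤ → List ℤ
act w v = foldr _⊕_ (replicate m (+ 0))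
            (zipWith (λ wk vk → scale (vk ℤ.* sgn wk) (basis m ∣ wk ∣)) w v)
  where m = length w

posRoots : ℕ → List (List ℤ)
posRoots m =
  map (basis m) (range1 m) ++
  concatMap (λ j → concatMap (λ i → (basis m j ⊖ basis m i) ∷ (basis m j ⊕ basis m i) ∷ [])
                              (range1 (j ∸ 1)))
            (range1 m)

negRoots : ℕ → List (List ℤ)
negRoots m = map (map (λ x → ℤ.- x)) (posRoots m)

Psi : ℕ → ℕ → List (List ℤ)
Psi m i = basis m a ∷ concatMap (λ j → (basis m a ⊖ basis m j) ∷ (basis m a ⊕ basis m j) ∷ [])
                                 (range1 (a ∸ 1))
  where a = suc m ∸ i

open import Data.List.Membership.DecPropositional (LP.≡-dec ℤ._≟_) using (_∈?_)

invᵢ : List ℤ → ℕ → ℕ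
invᵢ w i = length (filter (λ r → act w r ∈? negRoots m) (Psi m i))
  where m = length w

inv : List ℤ → ℕ
inv w = sum (map (invᵢ w) (range1 (length w)))

insertAfter : ℕ → ℤ → List ℤ → List ℤ
insertAfter i x w = take i w ++ x ∷ drop i w

module _ {c ℓ : Level} (R : CommutativeSemiring c ℓ) where
  open CommutativeSemiring R

  pow : Carrier → ℕ → Carrier
  pow q zero    = 1#
  pow q (suc k) = q * pow q k

  sumR : List Carrier → Carrier
  sumR = foldr _+_ 0#

  qint : ℕ → Carrier → Carrier
  qint n q = sumR (map (pow q) (upTo n))

{-# OPTIONS --safe #-}
module Submission where

-- Since w(e_k) = sgn(w_k) e_{|w_k|}, the image under w of a root e_a or e_a ∓ e_j (j < a) has a
-- last non-zero coordinate ±1, and it is a negative root exactly when that coordinate is -1.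
-- Hence inv_i(w), for a = m + 1 - i, is [w_a < 0] plus, for each j < a, either 2 [w_a < 0]
-- (if |w_j| < |w_a|) or 1, so inv(w) is a sum over the positions and the pairs of positions of
-- the one-line notation.  An entry ±n inserted after position i exceeds every other entry in
-- absolute value, so it contributes [±n < 0] for itself, 2 [±n < 0] for each of the i entries
-- before it and 1 for each of the n - 1 - i entries after it: n - 1 - i in all for +n and
-- n + i for -n.  Summing q^inv over i then gives [n]_q q^inv(π) and q^n [n]_q q^inv(π).

open import Defs
open import Level using (Level)
open import Function using (_∘_)
open import Data.Bool using (true; false; if_then_else_)
import Relation.Binary.PropositionalEquality as ≡
open ≡ using (_≡_; _≢_)
open import Data.Empty using (⊥-elim)
open import Data.Product using (_×_; _,_; ∃; ∃₂)
open import Data.Sum using (_⊎_; inj₁; inj₂)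
open import Data.Nat as ℕ using (ℕ; zero; suc; _≤_; _<_; _∸_; z≤n; s≤s; _<?_)
import Data.Nat.Properties as ℕP
open import Data.Nat.Tactic.RingSolver using (solve-∀)
open import Data.Nat.ListAction using (sum)
open import Data.Nat.ListAction.Properties using (sum-++; sum-↭)
open import Data.Integer as ℤ using (ℤ; +0; +[1+_]; -[1+_]; -_; ∣_∣; 0ℤ; 1ℤ; -1ℤ)
import Data.Integer.Properties as ℤP
open import Data.List
  using (List; []; _∷_; map; upTo; applyUpTo; length; zipWith; replicate; foldr; take; drop; _++_; filter; concatMap; _∷ʳ_)
import Data.List.Properties as LP
open import Data.List.Relation.Unary.All as All using (All; []; _∷_)
open import Data.List.Relation.Unary.Any using (here; there)
open import Data.List.Relation.Unary.Unique.Propositional using (Unique; _∷_)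
import Data.List.Relation.Unary.Unique.Propositional.Properties as Unique
open import Data.List.Membership.Propositional using (_∈_; _∉_; find; lose)
open import Data.List.Membership.Propositional.Properties
  using (∈-map⁺; ∈-map⁻; ∈-++⁺ˡ; ∈-++⁺ʳ; ∈-++⁻; ∈-concatMap⁺; ∈-concatMap⁻; ∈-applyUpTo⁺; ∈-applyUpTo⁻)
open import Data.List.Membership.DecPropositional (LP.≡-dec ℤ._≟_) using (_∈?_)
open import Data.List.Relation.Binary.Permutation.Propositional
  using (_↭_; prep; ↭-sym; ↭-trans; ↭-reflexive; ↭⇒↭ₛ)
open import Data.List.Relation.Binary.Permutation.Propositional.Properties
  using (Any-resp-↭; shift; ∷↭∷ʳ; ↭-length) renaming (map⁺ to ↭-map⁺)
open import Data.List.Relation.Binary.Permutation.Setoid.Properties (≡.setoid ℕ) using (Unique-resp-↭)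
open import Relation.Binary.Definitions using (tri<; tri≈; tri>)
open import Relation.Nullary using (does)
open import Relation.Nullary.Decidable using (dec-true; dec-false)
open import Relation.Unary using (Decidable)
open import Algebra.Bundles using (CommutativeSemiring)

-- Finite sums

module FiniteSum {c ℓ : Level} (R : CommutativeSemiring c ℓ) where
  open CommutativeSemiring R
  open import Relation.Binary.Reasoning.Setoid setoid

  ∑ : ℕ → (ℕ → Carrier) → Carrier
  ∑ zero    f = 0#
  ∑ (suc n) f = f 0 + ∑ n (f ∘ suc)

  sumR-map-upTo : ∀ (f : ℕ → Carrier) n → sumR R (map f (upTo n)) ≡ ∑ n f
  sumR-map-upTo f n = ≡.trans (≡.cong (sumR R) (LP.map-upTo f n)) (sumR-applyUpTo f n)
    where
    sumR-applyUpTo : ∀ (f : ℕ → Carrier) n → sumR R (applyUpTo f n) ≡ ∑ n f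
    sumR-applyUpTo f zero    = ≡.refl
    sumR-applyUpTo f (suc n) = ≡.cong (λ s → f 0 + s) (sumR-applyUpTo (f ∘ suc) n)

  ∑-cong : ∀ n {f g : ℕ → Carrier} → (∀ i → i < n → f i ≈ g i) → ∑ n f ≈ ∑ n g
  ∑-cong zero    f≈g = refl
  ∑-cong (suc n) f≈g = +-cong (f≈g 0 (s≤s z≤n)) (∑-cong n λ i i<n → f≈g (suc i) (s≤s i<n))

  ∑-zero : ∀ n {f : ℕ → Carrier} → (∀ i → i < n → f i ≈ 0#) → ∑ n f ≈ 0#
  ∑-zero zero    f≈0 = refl
  ∑-zero (suc n) f≈0 =
    trans (+-cong (f≈0 0 (s≤s z≤n)) (∑-zero n λ i i<n → f≈0 (suc i) (s≤s i<n))) (+-identityˡ 0#)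

  ∑-single : ∀ {n b} {f : ℕ → Carrier} → b < n → (∀ i → i < n → i ≢ b → f i ≈ 0#) → ∑ n f ≈ f b
  ∑-single {suc n} {zero} {f} _ f≈0 = begin
    f 0 + ∑ n (f ∘ suc) ≈⟨ +-congˡ (∑-zero n λ i i<n → f≈0 (suc i) (s≤s i<n) λ ()) ⟩
    f 0 + 0#            ≈⟨ +-identityʳ (f 0) ⟩
    f 0                 ∎
  ∑-single {suc n} {suc b} {f} (s≤s b<n) f≈0 = begin
    f 0 + ∑ n (f ∘ suc) ≈⟨ +-cong (f≈0 0 (s≤s z≤n) λ ())
                                  (∑-single b<n λ i i<n i≢b → f≈0 (suc i) (s≤s i<n) (i≢b ∘ ℕP.suc-injective)) ⟩
    0# + f (suc b)      ≈⟨ +-identityˡ (f (suc b)) ⟩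
    f (suc b)           ∎

  ∑-distrib-+ : ∀ n (f g : ℕ → Carrier) → ∑ n (λ i → f i + g i) ≈ ∑ n f + ∑ n g
  ∑-distrib-+ zero    f g = sym (+-identityˡ 0#)
  ∑-distrib-+ (suc n) f g = begin
    (f 0 + g 0) + ∑ n (λ i → f (suc i) + g (suc i)) ≈⟨ +-congˡ (∑-distrib-+ n (f ∘ suc) (g ∘ suc)) ⟩
    (f 0 + g 0) + (∑ n (f ∘ suc) + ∑ n (g ∘ suc))   ≈⟨ +-assoc (f 0) (g 0) _ ⟩
    f 0 + (g 0 + (∑ n (f ∘ suc) + ∑ n (g ∘ suc)))   ≈⟨ +-congˡ (x∙yz≈y∙xz (g 0) _ _) ⟩
    f 0 + (∑ n (f ∘ suc) + (g 0 + ∑ n (g ∘ suc)))   ≈⟨ +-assoc (f 0) _ _ ⟨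
    (f 0 + ∑ n (f ∘ suc)) + (g 0 + ∑ n (g ∘ suc))   ∎
    where open import Algebra.Properties.CommutativeSemigroup +-commutativeSemigroup using (x∙yz≈y∙xz)

  ∑-distribˡ : ∀ n a (f : ℕ → Carrier) → a * ∑ n f ≈ ∑ n (λ i → a * f i)
  ∑-distribˡ zero    a f = zeroʳ a
  ∑-distribˡ (suc n) a f = trans (distribˡ a (f 0) _) (+-congˡ (∑-distribˡ n a (f ∘ suc)))

  ∑-distribʳ : ∀ n a (f : ℕ → Carrier) → ∑ n f * a ≈ ∑ n (λ i → f i * a)
  ∑-distribʳ n a f = trans (*-comm _ a) (trans (∑-distribˡ n a f) (∑-cong n λ i _ → *-comm a (f i)))

  ∑-reverse : ∀ n (f : ℕ → Carrier) → ∑ n (λ i → f (n ∸ suc i)) ≈ ∑ n f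
  ∑-reverse zero    f = refl
  ∑-reverse (suc n) f = begin
    f n + ∑ n (λ i → f (n ∸ suc i)) ≈⟨ +-congˡ (∑-reverse n f) ⟩
    f n + ∑ n f                      ≈⟨ +-comm (f n) _ ⟩
    ∑ n f + f n                      ≈⟨ ∑-snoc n f ⟩
    ∑ (suc n) f                      ∎
    where
    ∑-snoc : ∀ n (f : ℕ → Carrier) → ∑ n f + f n ≈ ∑ (suc n) f
    ∑-snoc zero    f = +-comm 0# (f 0)
    ∑-snoc (suc n) f = trans (+-assoc (f 0) _ _) (+-congˡ (∑-snoc n (f ∘ suc)))

module QSum {c ℓ : Level} (R : CommutativeSemiring c ℓ) (q : CommutativeSemiring.Carrier R) where
  open CommutativeSemiring R
  open FiniteSum R
  open import Algebra.Properties.Semiring.Exp semiring using (_^_; ^-homo-*)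
  open import Relation.Binary.Reasoning.Setoid setoid

  pow-+ : ∀ a b → pow R q (a ℕ.+ b) ≈ pow R q a * pow R q b
  pow-+ a b = begin
    pow R q (a ℕ.+ b)     ≡⟨ pow≡^ (a ℕ.+ b) ⟩
    q ^ (a ℕ.+ b)         ≈⟨ ^-homo-* q a b ⟩
    q ^ a * q ^ b         ≡⟨ ≡.cong₂ _*_ (pow≡^ a) (pow≡^ b) ⟨
    pow R q a * pow R q b ∎
    where
    pow≡^ : ∀ n → pow R q n ≡ q ^ n
    pow≡^ zero    = ≡.refl
    pow≡^ (suc n) = ≡.cong (q *_) (pow≡^ n)

  sumR-pow-cong : ∀ n {f g : ℕ → ℕ} → (∀ i → i < n → f i ≡ g i) →
    sumR R (map (λ i → pow R q (f i)) (upTo n)) ≈ ∑ n (λ i → pow R q (g i))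
  sumR-pow-cong n f≡g =
    trans (reflexive (sumR-map-upTo _ n)) (∑-cong n λ i i<n → reflexive (≡.cong (pow R q) (f≡g i i<n)))

  ∑-pow-descending : ∀ n I → ∑ n (λ i → pow R q (I ℕ.+ (n ∸ suc i))) ≈ qint R n q * pow R q I
  ∑-pow-descending n I = begin
    ∑ n (λ i → pow R q (I ℕ.+ (n ∸ suc i)))   ≈⟨ ∑-cong n (λ i _ → trans (pow-+ I _) (*-comm _ _)) ⟩
    ∑ n (λ i → pow R q (n ∸ suc i) * pow R q I) ≈⟨ ∑-distribʳ n _ _ ⟨
    ∑ n (λ i → pow R q (n ∸ suc i)) * pow R q I ≈⟨ *-congʳ (∑-reverse n (pow R q)) ⟩
    ∑ n (pow R q) * pow R q I                  ≡⟨ ≡.cong (_* pow R q I) (sumR-map-upTo (pow R q) n) ⟨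
    qint R n q * pow R q I                     ∎

  ∑-pow-ascending : ∀ n I → ∑ n (λ i → pow R q (I ℕ.+ (n ℕ.+ i))) ≈ pow R q n * qint R n q * pow R q I
  ∑-pow-ascending n I = begin
    ∑ n (λ i → pow R q (I ℕ.+ (n ℕ.+ i)))
      ≈⟨ ∑-cong n (λ i _ → trans (pow-+ I _) (trans (*-comm _ _) (*-congʳ (pow-+ n i)))) ⟩
    ∑ n (λ i → pow R q n * pow R q i * pow R q I)   ≈⟨ ∑-distribʳ n _ _ ⟨
    ∑ n (λ i → pow R q n * pow R q i) * pow R q I   ≈⟨ *-congʳ (∑-distribˡ n _ _) ⟨
    pow R q n * ∑ n (pow R q) * pow R q I
      ≡⟨ ≡.cong (λ s → pow R q n * s * pow R q I) (sumR-map-upTo (pow R q) n) ⟨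
    pow R q n * qint R n q * pow R q I              ∎

open import Data.Nat using (_+_; _*_)
open ≡ using (refl; sym; trans; cong; cong₂; subst; module ≡-Reasoning)

module ℕ∑ = FiniteSum ℕP.+-*-commutativeSemiring
module ℤ∑ = FiniteSum ℤP.+-*-commutativeSemiring

-- Indexing from 0, with a default value past the end.
nth : {A : Set} → A → List A → ℕ → A
nth d []       _       = d
nth d (x ∷ xs) zero    = x
nth d (x ∷ xs) (suc k) = nth d xs k

nth-map : ∀ {A B : Set} {f : A → B} {d d'} → f d ≡ d' → ∀ xs k → nth d' (map f xs) k ≡ f (nth d xs k)
nth-map fd≡d' []       k       = sym fd≡d'
nth-map fd≡d' (x ∷ xs) zero    = refl
nth-map fd≡d' (x ∷ xs) (suc k) = nth-map fd≡d' xs k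

nth-∈ : ∀ {A : Set} (d : A) {xs k} → k < length xs → nth d xs k ∈ xs
nth-∈ d {_ ∷ _} {zero}  _         = here refl
nth-∈ d {_ ∷ _} {suc k} (s≤s k<n) = there (nth-∈ d k<n)

Unique-nth : ∀ {A : Set} (d : A) {xs j k} → Unique xs → j < k → k < length xs → nth d xs j ≢ nth d xs k
Unique-nth d {_ ∷ _} {zero}  {suc k} (x∉ ∷ _)  _         (s≤s k<n) = All.lookup x∉ (nth-∈ d k<n)
Unique-nth d {_ ∷ _} {suc j} {suc k} (_ ∷ uxs) (s≤s j<k) (s≤s k<n) = Unique-nth d uxs j<k k<n

sum-map-nth : ∀ {A : Set} (d : A) (f : A → ℕ) xs → sum (map f xs) ≡ ℕ∑.∑ (length xs) (f ∘ nth d xs)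
sum-map-nth d f []       = refl
sum-map-nth d f (x ∷ xs) = cong (λ s → f x + s) (sum-map-nth d f xs)

sum-map-concatMap : ∀ {A B : Set} (f : B → ℕ) (g : A → List B) xs →
  sum (map f (concatMap g xs)) ≡ sum (map (sum ∘ map f ∘ g) xs)
sum-map-concatMap f g []       = refl
sum-map-concatMap f g (x ∷ xs) = begin
  sum (map f (g x ++ concatMap g xs))             ≡⟨ cong sum (LP.map-++ f (g x) _) ⟩
  sum (map f (g x) ++ map f (concatMap g xs))     ≡⟨ sum-++ (map f (g x)) _ ⟩
  sum (map f (g x)) + sum (map f (concatMap g xs)) ≡⟨ cong (λ s → sum (map f (g x)) + s) (sum-map-concatMap f g xs) ⟩
  sum (map f (g x)) + sum (map (sum ∘ map f ∘ g) xs) ∎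
  where open ≡-Reasoning

length-filter : ∀ {A : Set} {P : A → Set} (P? : Decidable P) xs →
  length (filter P? xs) ≡ sum (map (λ x → if does (P? x) then 1 else 0) xs)
length-filter P? []       = refl
length-filter P? (x ∷ xs) with does (P? x)
... | true  = cong suc (length-filter P? xs)
... | false = length-filter P? xs

applyUpTo-cong : ∀ {A : Set} n {f g : ℕ → A} → (∀ k → k < n → f k ≡ g k) → applyUpTo f n ≡ applyUpTo g n
applyUpTo-cong zero    _   = refl
applyUpTo-cong (suc n) f≡g = cong₂ _∷_ (f≡g 0 (s≤s z≤n)) (applyUpTo-cong n λ k k<n → f≡g (suc k) (s≤s k<n))

applyUpTo-injective : ∀ {A : Set} n {f g : ℕ → A} → applyUpTo f n ≡ applyUpTo g n → ∀ k → k < n → f k ≡ g k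
applyUpTo-injective (suc n) eq zero    _         = LP.∷-injectiveˡ eq
applyUpTo-injective (suc n) eq (suc k) (s≤s k<n) = applyUpTo-injective n (LP.∷-injectiveʳ eq) k k<n

zipWith-applyUpTo : ∀ {A B C : Set} (_∙_ : A → B → C) n f g →
  zipWith _∙_ (applyUpTo f n) (applyUpTo g n) ≡ applyUpTo (λ k → f k ∙ g k) n
zipWith-applyUpTo _∙_ zero    f g = refl
zipWith-applyUpTo _∙_ (suc n) f g = cong (f 0 ∙ g 0 ∷_) (zipWith-applyUpTo _∙_ n (f ∘ suc) (g ∘ suc))

replicate-applyUpTo : ∀ {A : Set} n (x : A) → replicate n x ≡ applyUpTo (λ _ → x) n
replicate-applyUpTo zero    x = refl
replicate-applyUpTo (suc n) x = cong (x ∷_) (replicate-applyUpTo n x)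

range1-applyUpTo : ∀ m → range1 m ≡ applyUpTo suc m
range1-applyUpTo = LP.map-upTo suc

∈-range1⁺ : ∀ {p m} → p < m → suc p ∈ range1 m
∈-range1⁺ {m = m} p<m = subst (_ ∈_) (sym (range1-applyUpTo m)) (∈-applyUpTo⁺ suc p<m)

∈-range1⁻ : ∀ {l m} → l ∈ range1 m → ∃ λ p → p < m × l ≡ suc p
∈-range1⁻ {m = m} l∈ = ∈-applyUpTo⁻ suc (subst (_ ∈_) (range1-applyUpTo m) l∈)

sum-map-range1 : ∀ (f : ℕ → ℕ) n → sum (map f (range1 n)) ≡ ℕ∑.∑ n (f ∘ suc)
sum-map-range1 f n = trans (cong sum (sym (LP.map-∘ (upTo n)))) (ℕ∑.sumR-map-upTo (f ∘ suc) n)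

-- Vectors and roots

δ : ℕ → ℕ → ℤ
δ k l = if k ℕ.≡ᵇ l then 1ℤ else 0ℤ

δ-refl : ∀ k → δ k k ≡ 1ℤ
δ-refl zero    = refl
δ-refl (suc k) = δ-refl k

δ-≢ : ∀ {k l} → k ≢ l → δ k l ≡ 0ℤ
δ-≢ {zero}  {zero}  k≢l = ⊥-elim (k≢l refl)
δ-≢ {zero}  {suc l} _   = refl
δ-≢ {suc k} {zero}  _   = refl
δ-≢ {suc k} {suc l} k≢l = δ-≢ (k≢l ∘ cong suc)

basis-applyUpTo : ∀ m l → basis m l ≡ applyUpTo (λ k → δ (suc k) l) m
basis-applyUpTo m l = trans (cong (map _) (range1-applyUpTo m)) (LP.map-applyUpTo suc _ m)

-- Vector indices are 0-based from here on: e m p is the basis vector e_{p+1} of ℤ^m.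
e : ℕ → ℕ → List ℤ
e m p = basis m (suc p)

single : ℕ → ℤ → ℕ → List ℤ
single m s p = applyUpTo (λ k → s ℤ.* δ k p) m

double : ℕ → ℤ → ℕ → ℤ → ℕ → List ℤ
double m s p t p' = applyUpTo (λ k → s ℤ.* δ k p ℤ.+ t ℤ.* δ k p') m

e≡single : ∀ m p → e m p ≡ single m 1ℤ p
e≡single m p = trans (basis-applyUpTo m (suc p)) (applyUpTo-cong m λ k _ → sym (ℤP.*-identityˡ (δ k p)))

e⊖e≡double : ∀ m p p' → e m p ⊖ e m p' ≡ double m 1ℤ p -1ℤ p'
e⊖e≡double m p p' = begin
  e m p ⊖ e m p'                       ≡⟨ cong₂ _⊖_ (basis-applyUpTo m (suc p)) (basis-applyUpTo m (suc p')) ⟩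
  _                                    ≡⟨ zipWith-applyUpTo ℤ._-_ m _ _ ⟩
  applyUpTo (λ k → δ k p ℤ.- δ k p') m
    ≡⟨ applyUpTo-cong m (λ k _ → cong₂ ℤ._+_ (sym (ℤP.*-identityˡ (δ k p))) (sym (ℤP.-1*i≡-i (δ k p')))) ⟩
  double m 1ℤ p -1ℤ p'                 ∎
  where open ≡-Reasoning

e⊕e≡double : ∀ m p p' → e m p ⊕ e m p' ≡ double m 1ℤ p 1ℤ p'
e⊕e≡double m p p' = begin
  e m p ⊕ e m p'                       ≡⟨ cong₂ _⊕_ (basis-applyUpTo m (suc p)) (basis-applyUpTo m (suc p')) ⟩
  _                                    ≡⟨ zipWith-applyUpTo ℤ._+_ m _ _ ⟩
  applyUpTo (λ k → δ k p ℤ.+ δ k p') m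
    ≡⟨ applyUpTo-cong m (λ k _ → cong₂ ℤ._+_ (sym (ℤP.*-identityˡ (δ k p))) (sym (ℤP.*-identityˡ (δ k p')))) ⟩
  double m 1ℤ p 1ℤ p'                  ∎
  where open ≡-Reasoning

neg-single : ∀ m s p → map -_ (single m s p) ≡ single m (- s) p
neg-single m s p = trans (LP.map-applyUpTo _ -_ m) (applyUpTo-cong m λ k _ → ℤP.neg-distribˡ-* s (δ k p))

neg-double : ∀ m s p t p' → map -_ (double m s p t p') ≡ double m (- s) p (- t) p'
neg-double m s p t p' = trans (LP.map-applyUpTo _ -_ m) (applyUpTo-cong m λ k _ →
  trans (ℤP.neg-distrib-+ (s ℤ.* δ k p) _) (cong₂ ℤ._+_ (ℤP.neg-distribˡ-* s _) (ℤP.neg-distribˡ-* t _)))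

double-comm : ∀ m s p t p' → double m s p t p' ≡ double m t p' s p
double-comm m s p t p' = applyUpTo-cong m λ k _ → ℤP.+-comm (s ℤ.* δ k p) _

-- s is the leading coefficient of f below m, at p; a root is negative exactly when it is -1.
Leads : ℕ → (ℕ → ℤ) → ℕ → ℤ → Set
Leads m f p s = p < m × f p ≡ s × (∀ k → p < k → k < m → f k ≡ 0ℤ)

Leads-functional : ∀ {m f p p' s s'} → s ≢ 0ℤ → s' ≢ 0ℤ → Leads m f p s → Leads m f p' s' → s ≡ s'
Leads-functional {p = p} {p'} s≢0 s'≢0 (p<m , fp , above) (p'<m , fp' , above') with ℕP.<-cmp p p'
... | tri< p<p' _ _ = ⊥-elim (s'≢0 (trans (sym fp') (above _ p<p' p'<m)))
... | tri≈ _ refl _ = trans (sym fp) fp'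
... | tri> _ _ p'<p = ⊥-elim (s≢0 (trans (sym fp) (above' _ p'<p p<m)))

Leads-resp : ∀ {m f g p s} → (∀ k → k < m → f k ≡ g k) → Leads m f p s → Leads m g p s
Leads-resp f≡g (p<m , fp , above) =
  p<m , trans (sym (f≡g _ p<m)) fp , λ k p<k k<m → trans (sym (f≡g k k<m)) (above k p<k k<m)

Leads-neg : ∀ {m f p s} → Leads m f p s → Leads m (-_ ∘ f) p (- s)
Leads-neg (p<m , fp , above) = p<m , cong -_ fp , λ k p<k k<m → cong -_ (above k p<k k<m)

Leads-single : ∀ {m s p} → p < m → Leads m (λ k → s ℤ.* δ k p) p s
Leads-single {s = s} {p} p<m =
  p<m , trans (cong (s ℤ.*_) (δ-refl p)) (ℤP.*-identityʳ s) ,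
  λ k p<k _ → trans (cong (s ℤ.*_) (δ-≢ (ℕP.>⇒≢ p<k))) (ℤP.*-zeroʳ s)

Leads-double : ∀ {m s t p p'} → p' < p → p < m → Leads m (λ k → s ℤ.* δ k p ℤ.+ t ℤ.* δ k p') p s
Leads-double {s = s} {t} {p} p'<p p<m =
  p<m , trans (cong₂ (λ a b → s ℤ.* a ℤ.+ t ℤ.* b) (δ-refl p) (δ-≢ (ℕP.>⇒≢ p'<p))) s*1+t*0≡s ,
  λ k p<k _ → trans (cong₂ (λ a b → s ℤ.* a ℤ.+ t ℤ.* b) (δ-≢ (ℕP.>⇒≢ p<k)) (δ-≢ (ℕP.>⇒≢ (ℕP.<-trans p'<p p<k))))
                    s*0+t*0≡0
  where
  s*1+t*0≡s : s ℤ.* 1ℤ ℤ.+ t ℤ.* 0ℤ ≡ s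
  s*1+t*0≡s = trans (cong₂ ℤ._+_ (ℤP.*-identityʳ s) (ℤP.*-zeroʳ t)) (ℤP.+-identityʳ s)
  s*0+t*0≡0 : s ℤ.* 0ℤ ℤ.+ t ℤ.* 0ℤ ≡ 0ℤ
  s*0+t*0≡0 = cong₂ ℤ._+_ (ℤP.*-zeroʳ s) (ℤP.*-zeroʳ t)

data PosRoot (m : ℕ) : List ℤ → Set where
  basisRoot : ∀ {p}    → p < m → PosRoot m (e m p)
  diffRoot  : ∀ {p p'} → p' < p → p < m → PosRoot m (e m p ⊖ e m p')
  sumRoot   : ∀ {p p'} → p' < p → p < m → PosRoot m (e m p ⊕ e m p')

∈-posRoots⁺ : ∀ {m v} → PosRoot m v → v ∈ posRoots m
∈-posRoots⁺ {m} (basisRoot p<m)    = ∈-++⁺ˡ (∈-map⁺ (basis m) (∈-range1⁺ p<m))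
∈-posRoots⁺ {m} (diffRoot p'<p p<m) =
  ∈-++⁺ʳ _ (∈-concatMap⁺ _ (lose (∈-range1⁺ p<m) (∈-concatMap⁺ _ (lose (∈-range1⁺ p'<p) (here refl)))))
∈-posRoots⁺ {m} (sumRoot p'<p p<m)  =
  ∈-++⁺ʳ _ (∈-concatMap⁺ _ (lose (∈-range1⁺ p<m) (∈-concatMap⁺ _ (lose (∈-range1⁺ p'<p) (there (here refl))))))

∈-posRoots⁻ : ∀ {m v} → v ∈ posRoots m → PosRoot m v
∈-posRoots⁻ {m} v∈ with ∈-++⁻ (map (basis m) (range1 m)) v∈
... | inj₁ v∈basis with ∈-map⁻ (basis m) v∈basis
...   | l , l∈ , refl with ∈-range1⁻ l∈
...     | p , p<m , refl = basisRoot p<m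
∈-posRoots⁻ {m} v∈ | inj₂ v∈pairs with find (∈-concatMap⁻ _ {xs = range1 m} v∈pairs)
... | j , j∈ , v∈j with ∈-range1⁻ j∈
... | p , p<m , refl with find (∈-concatMap⁻ _ {xs = range1 p} v∈j)
... | i , i∈ , v∈ji with ∈-range1⁻ i∈
... | p' , p'<p , refl with v∈ji
... | here refl         = diffRoot p'<p p<m
... | there (here refl) = sumRoot p'<p p<m

PosRoot-leads : ∀ {m v} → PosRoot m v → ∃₂ λ f p → v ≡ applyUpTo f m × Leads m f p 1ℤ
PosRoot-leads {m} (basisRoot {p} p<m)        = _ , _ , e≡single m p , Leads-single {s = 1ℤ} p<m
PosRoot-leads {m} (diffRoot {p} {p'} p'<p p<m) = _ , _ , e⊖e≡double m p p' , Leads-double {s = 1ℤ} { -1ℤ} p'<p p<m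
PosRoot-leads {m} (sumRoot {p} {p'} p'<p p<m)  = _ , _ , e⊕e≡double m p p' , Leads-double {s = 1ℤ} {1ℤ} p'<p p<m

negRoot-leads : ∀ {m u} → u ∈ negRoots m → ∃₂ λ f p → u ≡ applyUpTo f m × Leads m f p -1ℤ
negRoot-leads {m} u∈ with ∈-map⁻ (map -_) u∈
... | v , v∈ , refl with PosRoot-leads (∈-posRoots⁻ {m} v∈)
... | f , p , refl , leads = -_ ∘ f , p , LP.map-applyUpTo f -_ m , Leads-neg leads

Leads-1ℤ⇒∉negRoots : ∀ {m f p} → Leads m f p 1ℤ → applyUpTo f m ∉ negRoots m
Leads-1ℤ⇒∉negRoots {m} leads u∈ with negRoot-leads u∈
... | g , p' , f≡g , leads' with Leads-functional (λ ()) (λ ()) leads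
                                   (Leads-resp (λ k k<m → sym (applyUpTo-injective m f≡g k k<m)) leads')
... | ()

neg-PosRoot∈negRoots : ∀ {m v} → PosRoot m v → map -_ v ∈ negRoots m
neg-PosRoot∈negRoots r = ∈-map⁺ (map -_) (∈-posRoots⁺ r)

IsSign : ℤ → Set
IsSign s = s ≡ 1ℤ ⊎ s ≡ -1ℤ

[_<0] : ℤ → ℕ
[ +0       <0] = 0
[ +[1+ _ ] <0] = 0
[ -[1+ _ ] <0] = 1

sgn-IsSign : ∀ x {P} → ∣ x ∣ ≡ suc P → IsSign (sgn x)
sgn-IsSign +[1+ _ ] _ = inj₁ refl
sgn-IsSign -[1+ _ ] _ = inj₂ refl

[sgn<0] : ∀ x → [ sgn x <0] ≡ [ x <0]
[sgn<0] +0         = refl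
[sgn<0] +[1+ _ ]   = refl
[sgn<0] -[1+ _ ]   = refl

[-s<0]+[s<0] : ∀ {s} → IsSign s → [ - s <0] + [ s <0] ≡ 1
[-s<0]+[s<0] (inj₁ refl) = refl
[-s<0]+[s<0] (inj₂ refl) = refl

IsSign-neg : ∀ {s} → IsSign s → IsSign (- s)
IsSign-neg (inj₁ refl) = inj₂ refl
IsSign-neg (inj₂ refl) = inj₁ refl

χ : ℕ → List ℤ → ℕ
χ m u = if does (u ∈? negRoots m) then 1 else 0

χ-∈ : ∀ {m u} → u ∈ negRoots m → χ m u ≡ 1
χ-∈ {m} {u} u∈ rewrite dec-true (u ∈? negRoots m) u∈ = refl

χ-∉ : ∀ {m u} → u ∉ negRoots m → χ m u ≡ 0
χ-∉ {m} {u} u∉ rewrite dec-false (u ∈? negRoots m) u∉ = refl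

χ-single : ∀ {m s p} → p < m → IsSign s → χ m (single m s p) ≡ [ s <0]
χ-single {m} p<m (inj₁ refl) = χ-∉ {m} (Leads-1ℤ⇒∉negRoots (Leads-single p<m))
χ-single {m} {p = p} p<m (inj₂ refl) =
  χ-∈ {m} (subst (_∈ negRoots m) (trans (cong (map -_) (e≡single m p)) (neg-single m 1ℤ p))
             (neg-PosRoot∈negRoots (basisRoot p<m)))

χ-double : ∀ {m s t p p'} → p' < p → p < m → IsSign s → IsSign t → χ m (double m s p t p') ≡ [ s <0]
χ-double {m} {t = t} p'<p p<m (inj₁ refl) _ = χ-∉ {m} (Leads-1ℤ⇒∉negRoots (Leads-double {t = t} p'<p p<m))
χ-double {m} {p = p} {p'} p'<p p<m (inj₂ refl) (inj₁ refl) =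
  χ-∈ {m} (subst (_∈ negRoots m) (trans (cong (map -_) (e⊖e≡double m p p')) (neg-double m 1ℤ p -1ℤ p'))
             (neg-PosRoot∈negRoots (diffRoot p'<p p<m)))
χ-double {m} {p = p} {p'} p'<p p<m (inj₂ refl) (inj₂ refl) =
  χ-∈ {m} (subst (_∈ negRoots m) (trans (cong (map -_) (e⊕e≡double m p p')) (neg-double m 1ℤ p 1ℤ p'))
             (neg-PosRoot∈negRoots (sumRoot p'<p p<m)))

-- The action of a signed permutation on roots

_‼_ : List ℤ → ℕ → ℤ
w ‼ j = nth 0ℤ w j

-- act w is actIn (length w) w; with the dimension a separate parameter, induction on w leaves it fixed.
actIn : ℕ → List ℤ → List ℤ → List ℤ
actIn m w v = foldr _⊕_ (replicate m 0ℤ) (zipWith (λ wk vk → scale (vk ℤ.* sgn wk) (basis m ∣ wk ∣)) w v)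

-- The k-th coordinate of w(e_{j+1}) = sgn(x) e_{|x|}, for x = w ‼ j.
column : ℤ → ℕ → ℤ
column x k = sgn x ℤ.* δ (suc k) ∣ x ∣

actIn-applyUpTo : ∀ m w h →
  actIn m w (applyUpTo h (length w)) ≡ applyUpTo (λ k → ℤ∑.∑ (length w) (λ j → h j ℤ.* column (w ‼ j) k)) m
actIn-applyUpTo m []      h = replicate-applyUpTo m 0ℤ
actIn-applyUpTo m (x ∷ w) h = begin
  scale (h 0 ℤ.* sgn x) (basis m ∣ x ∣) ⊕ actIn m w (applyUpTo (h ∘ suc) (length w))
    ≡⟨ cong₂ _⊕_ (trans (cong (scale (h 0 ℤ.* sgn x)) (basis-applyUpTo m ∣ x ∣)) (LP.map-applyUpTo _ _ m))
                 (actIn-applyUpTo m w (h ∘ suc)) ⟩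
  applyUpTo (λ k → h 0 ℤ.* sgn x ℤ.* δ (suc k) ∣ x ∣) m ⊕ applyUpTo Σrest m
    ≡⟨ zipWith-applyUpTo ℤ._+_ m _ _ ⟩
  applyUpTo (λ k → h 0 ℤ.* sgn x ℤ.* δ (suc k) ∣ x ∣ ℤ.+ Σrest k) m
    ≡⟨ applyUpTo-cong m (λ k _ → cong (ℤ._+ Σrest k) (ℤP.*-assoc (h 0) (sgn x) _)) ⟩
  applyUpTo (λ k → ℤ∑.∑ (length (x ∷ w)) (λ j → h j ℤ.* column ((x ∷ w) ‼ j) k)) m ∎
  where
  open ≡-Reasoning
  Σrest : ℕ → ℤ
  Σrest k = ℤ∑.∑ (length w) (λ j → h (suc j) ℤ.* column (w ‼ j) k)

∑-δ : ∀ {n b} s (F : ℕ → ℤ) → b < n → ℤ∑.∑ n (λ i → s ℤ.* δ i b ℤ.* F i) ≡ s ℤ.* F b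
∑-δ {n} {b} s F b<n = begin
  ℤ∑.∑ n (λ i → s ℤ.* δ i b ℤ.* F i) ≡⟨ ℤ∑.∑-single b<n (λ i _ i≢b →
                                          trans (cong (λ d → s ℤ.* d ℤ.* F i) (δ-≢ i≢b))
                                                (trans (cong (ℤ._* F i) (ℤP.*-zeroʳ s)) (ℤP.*-zeroˡ (F i)))) ⟩
  s ℤ.* δ b b ℤ.* F b                 ≡⟨ cong (λ d → s ℤ.* d ℤ.* F b) (δ-refl b) ⟩
  s ℤ.* 1ℤ ℤ.* F b                    ≡⟨ cong (ℤ._* F b) (ℤP.*-identityʳ s) ⟩
  s ℤ.* F b                           ∎
  where open ≡-Reasoning

∑-δ₂ : ∀ {n b j} s t (F : ℕ → ℤ) → b < n → j < n →
  ℤ∑.∑ n (λ i → (s ℤ.* δ i b ℤ.+ t ℤ.* δ i j) ℤ.* F i) ≡ s ℤ.* F b ℤ.+ t ℤ.* F j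
∑-δ₂ {n} {b} {j} s t F b<n j<n = begin
  ℤ∑.∑ n (λ i → (s ℤ.* δ i b ℤ.+ t ℤ.* δ i j) ℤ.* F i)
    ≡⟨ ℤ∑.∑-cong n (λ i _ → ℤP.*-distribʳ-+ (F i) (s ℤ.* δ i b) _) ⟩
  ℤ∑.∑ n (λ i → s ℤ.* δ i b ℤ.* F i ℤ.+ t ℤ.* δ i j ℤ.* F i)
    ≡⟨ ℤ∑.∑-distrib-+ n _ _ ⟩
  ℤ∑.∑ n (λ i → s ℤ.* δ i b ℤ.* F i) ℤ.+ ℤ∑.∑ n (λ i → t ℤ.* δ i j ℤ.* F i)
    ≡⟨ cong₂ ℤ._+_ (∑-δ s F b<n) (∑-δ t F j<n) ⟩
  s ℤ.* F b ℤ.+ t ℤ.* F j ∎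
  where open ≡-Reasoning

*-column : ∀ s {x P} k → ∣ x ∣ ≡ suc P → s ℤ.* column x k ≡ s ℤ.* sgn x ℤ.* δ k P
*-column s {x} k ∣x∣≡1+P =
  trans (cong (λ l → s ℤ.* (sgn x ℤ.* δ (suc k) l)) ∣x∣≡1+P) (sym (ℤP.*-assoc s (sgn x) _))

act-single : ∀ w {b P} s → b < length w → ∣ w ‼ b ∣ ≡ suc P →
  act w (single (length w) s b) ≡ single (length w) (s ℤ.* sgn (w ‼ b)) P
act-single w s b<m ∣wb∣ = trans (actIn-applyUpTo (length w) w _) (applyUpTo-cong (length w) λ k _ →
  trans (∑-δ s (λ j → column (w ‼ j) k) b<m) (*-column s k ∣wb∣))

act-double : ∀ w {b j P P'} s t → b < length w → j < length w → ∣ w ‼ b ∣ ≡ suc P → ∣ w ‼ j ∣ ≡ suc P' →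
  act w (double (length w) s b t j) ≡ double (length w) (s ℤ.* sgn (w ‼ b)) P (t ℤ.* sgn (w ‼ j)) P'
act-double w s t b<m j<m ∣wb∣ ∣wj∣ = trans (actIn-applyUpTo (length w) w _) (applyUpTo-cong (length w) λ k _ →
  trans (∑-δ₂ s t (λ i → column (w ‼ i) k) b<m j<m) (cong₂ ℤ._+_ (*-column s k ∣wb∣) (*-column t k ∣wj∣)))

act-e : ∀ w {b P} → b < length w → ∣ w ‼ b ∣ ≡ suc P →
  act w (e (length w) b) ≡ single (length w) (sgn (w ‼ b)) P
act-e w {b} {P} b<m ∣wb∣ = begin
  act w (e m b)                        ≡⟨ cong (act w) (e≡single m b) ⟩
  act w (single m 1ℤ b)                ≡⟨ act-single w 1ℤ b<m ∣wb∣ ⟩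
  single m (1ℤ ℤ.* sgn (w ‼ b)) P      ≡⟨ cong (λ s → single m s P) (ℤP.*-identityˡ (sgn (w ‼ b))) ⟩
  single m (sgn (w ‼ b)) P             ∎
  where
  open ≡-Reasoning
  m : ℕ
  m = length w

act-e⊖e : ∀ w {b j P P'} → b < length w → j < length w → ∣ w ‼ b ∣ ≡ suc P → ∣ w ‼ j ∣ ≡ suc P' →
  act w (e (length w) b ⊖ e (length w) j) ≡ double (length w) (sgn (w ‼ b)) P (- sgn (w ‼ j)) P'
act-e⊖e w {b} {j} {P} {P'} b<m j<m ∣wb∣ ∣wj∣ = begin
  act w (e m b ⊖ e m j)
    ≡⟨ cong (act w) (e⊖e≡double m b j) ⟩
  act w (double m 1ℤ b -1ℤ j)
    ≡⟨ act-double w 1ℤ -1ℤ b<m j<m ∣wb∣ ∣wj∣ ⟩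
  double m (1ℤ ℤ.* sgn (w ‼ b)) P (-1ℤ ℤ.* sgn (w ‼ j)) P'
    ≡⟨ cong₂ (λ s t → double m s P t P') (ℤP.*-identityˡ (sgn (w ‼ b))) (ℤP.-1*i≡-i (sgn (w ‼ j))) ⟩
  double m (sgn (w ‼ b)) P (- sgn (w ‼ j)) P' ∎
  where
  open ≡-Reasoning
  m : ℕ
  m = length w

act-e⊕e : ∀ w {b j P P'} → b < length w → j < length w → ∣ w ‼ b ∣ ≡ suc P → ∣ w ‼ j ∣ ≡ suc P' →
  act w (e (length w) b ⊕ e (length w) j) ≡ double (length w) (sgn (w ‼ b)) P (sgn (w ‼ j)) P'
act-e⊕e w {b} {j} {P} {P'} b<m j<m ∣wb∣ ∣wj∣ = begin
  act w (e m b ⊕ e m j)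
    ≡⟨ cong (act w) (e⊕e≡double m b j) ⟩
  act w (double m 1ℤ b 1ℤ j)
    ≡⟨ act-double w 1ℤ 1ℤ b<m j<m ∣wb∣ ∣wj∣ ⟩
  double m (1ℤ ℤ.* sgn (w ‼ b)) P (1ℤ ℤ.* sgn (w ‼ j)) P'
    ≡⟨ cong₂ (λ s t → double m s P t P') (ℤP.*-identityˡ (sgn (w ‼ b))) (ℤP.*-identityˡ (sgn (w ‼ j))) ⟩
  double m (sgn (w ‼ b)) P (sgn (w ‼ j)) P' ∎
  where
  open ≡-Reasoning
  m : ℕ
  m = length w

-- inv as a sum over positions and pairs of positions

-- For entries y = w(j) and x = w(b) with j < b, this is the number of negative roots among w(e_b ∓ e_j).
pairInv : ℤ → ℤ → ℕ
pairInv y x = if does (∣ y ∣ <? ∣ x ∣) then 2 * [ x <0] else 1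

pairInv-< : ∀ {y x} → ∣ y ∣ < ∣ x ∣ → pairInv y x ≡ 2 * [ x <0]
pairInv-< {y} {x} lt rewrite dec-true (∣ y ∣ <? ∣ x ∣) lt = refl

pairInv-> : ∀ {y x} → ∣ x ∣ < ∣ y ∣ → pairInv y x ≡ 1
pairInv-> {y} {x} gt rewrite dec-false (∣ y ∣ <? ∣ x ∣) (ℕP.<-asym gt) = refl

row : List ℤ → ℕ → ℕ
row w b = [ w ‼ b <0] + ℕ∑.∑ b (λ j → pairInv (w ‼ j) (w ‼ b))

invList : List ℤ → ℕ
invList []      = 0
invList (x ∷ w) = [ x <0] + sum (map (pairInv x) w) + invList w

∑-row≡invList : ∀ w → ℕ∑.∑ (length w) (row w) ≡ invList w
∑-row≡invList []      = refl
∑-row≡invList (x ∷ w) = begin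
  ([ x <0] + 0) + ℕ∑.∑ n (λ b → [ w ‼ b <0] + (pairInv x (w ‼ b) + S b))
    ≡⟨ cong (([ x <0] + 0) +_) (ℕ∑.∑-cong n λ b _ → x∙yz≈y∙xz [ w ‼ b <0] (pairInv x (w ‼ b)) (S b)) ⟩
  ([ x <0] + 0) + ℕ∑.∑ n (λ b → pairInv x (w ‼ b) + row w b)
    ≡⟨ cong (([ x <0] + 0) +_) (ℕ∑.∑-distrib-+ n _ _) ⟩
  ([ x <0] + 0) + (ℕ∑.∑ n (pairInv x ∘ (w ‼_)) + ℕ∑.∑ n (row w))
    ≡⟨ cong₂ (λ a b → ([ x <0] + 0) + (a + b)) (sym (sum-map-nth 0ℤ (pairInv x) w)) (∑-row≡invList w) ⟩
  ([ x <0] + 0) + (sum (map (pairInv x) w) + invList w)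
    ≡⟨ trans (cong (_+ (sum (map (pairInv x) w) + invList w)) (ℕP.+-identityʳ [ x <0]))
             (sym (ℕP.+-assoc [ x <0] (sum (map (pairInv x) w)) (invList w))) ⟩
  [ x <0] + sum (map (pairInv x) w) + invList w ∎
  where
  open ≡-Reasoning
  open import Algebra.Properties.CommutativeSemigroup ℕP.+-commutativeSemigroup using (x∙yz≈y∙xz)
  n = length w
  S : ℕ → ℕ
  S b = ℕ∑.∑ b (λ j → pairInv (w ‼ j) (w ‼ b))

χ-double-pair : ∀ {m} x y {P P'} → ∣ x ∣ ≡ suc P → ∣ y ∣ ≡ suc P' → P ≢ P' → P < m → P' < m →
  χ m (double m (sgn x) P (- sgn y) P') + χ m (double m (sgn x) P (sgn y) P') ≡ pairInv y x
χ-double-pair {m} x y {P} {P'} ∣x∣ ∣y∣ P≢P' P<m P'<m with ℕP.<-cmp P' P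
... | tri< P'<P _ _ = begin
  χ m (double m (sgn x) P (- sgn y) P') + χ m (double m (sgn x) P (sgn y) P')
    ≡⟨ cong₂ _+_ (χ-double P'<P P<m sx (IsSign-neg sy)) (χ-double P'<P P<m sx sy) ⟩
  [ sgn x <0] + [ sgn x <0] ≡⟨ cong (λ n → n + n) ([sgn<0] x) ⟩
  [ x <0] + [ x <0]         ≡⟨ cong ([ x <0] +_) (ℕP.+-identityʳ [ x <0]) ⟨
  2 * [ x <0]               ≡⟨ pairInv-< {y} {x} (≡.subst₂ _<_ (sym ∣y∣) (sym ∣x∣) (s≤s P'<P)) ⟨
  pairInv y x               ∎
  where
  open ≡-Reasoning
  sx : IsSign (sgn x)
  sx = sgn-IsSign x ∣x∣
  sy : IsSign (sgn y)
  sy = sgn-IsSign y ∣y∣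
... | tri≈ _ P'≡P _ = ⊥-elim (P≢P' (sym P'≡P))
... | tri> _ _ P<P' = begin
  χ m (double m (sgn x) P (- sgn y) P') + χ m (double m (sgn x) P (sgn y) P')
    ≡⟨ cong₂ _+_ (cong (χ m) (double-comm m (sgn x) P (- sgn y) P'))
                 (cong (χ m) (double-comm m (sgn x) P (sgn y) P')) ⟩
  χ m (double m (- sgn y) P' (sgn x) P) + χ m (double m (sgn y) P' (sgn x) P)
    ≡⟨ cong₂ _+_ (χ-double P<P' P'<m (IsSign-neg sy) sx) (χ-double P<P' P'<m sy sx) ⟩
  [ - sgn y <0] + [ sgn y <0] ≡⟨ [-s<0]+[s<0] sy ⟩
  1                           ≡⟨ pairInv-> {y} {x} (≡.subst₂ _<_ (sym ∣x∣) (sym ∣y∣) (s≤s P<P')) ⟨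
  pairInv y x                 ∎
  where
  open ≡-Reasoning
  sx : IsSign (sgn x)
  sx = sgn-IsSign x ∣x∣
  sy : IsSign (sgn y)
  sy = sgn-IsSign y ∣y∣

-- Ψ_i of B_m, indexed by a = m + 1 - i.
rootsAt : ℕ → ℕ → List (List ℤ)
rootsAt m a = basis m a ∷ concatMap (λ j → (basis m a ⊖ basis m j) ∷ (basis m a ⊕ basis m j) ∷ []) (range1 (a ∸ 1))

module SignedPerm {w : List ℤ} (σ : IsSignedPerm w) where

  m : ℕ
  m = length w

  ∣‼∣-range1 : ∀ {j} → j < m → ∃ λ P → P < m × ∣ w ‼ j ∣ ≡ suc P
  ∣‼∣-range1 j<m = ∈-range1⁻ (Any-resp-↭ σ (∈-map⁺ ∣_∣ (nth-∈ 0ℤ j<m)))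

  ∣‼∣-injective : ∀ {j k} → j < k → k < m → ∣ w ‼ j ∣ ≢ ∣ w ‼ k ∣
  ∣‼∣-injective {j} {k} j<k k<m ∣wj∣≡∣wk∣ =
    Unique-nth 0 ∣w∣-unique j<k (subst (k <_) (sym (LP.length-map ∣_∣ w)) k<m)
      (trans (nth-map refl w j) (trans ∣wj∣≡∣wk∣ (sym (nth-map refl w k))))
    where
    ∣w∣-unique : Unique (map ∣_∣ w)
    ∣w∣-unique = Unique-resp-↭ (↭⇒↭ₛ (↭-sym σ)) (Unique.map⁺ ℕP.suc-injective (Unique.upTo⁺ m))

  ∣entries∣<1+m : All (λ y → ∣ y ∣ < suc m) w
  ∣entries∣<1+m = All.tabulate λ {y} y∈w → bound y (∈-range1⁻ (Any-resp-↭ σ (∈-map⁺ ∣_∣ y∈w)))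
    where
    bound : ∀ y → (∃ λ P → P < m × ∣ y ∣ ≡ suc P) → ∣ y ∣ < suc m
    bound y (P , P<m , ∣y∣≡1+P) = subst (_< suc m) (sym ∣y∣≡1+P) (s≤s P<m)

  χ-act-e : ∀ {b} → b < m → χ m (act w (e m b)) ≡ [ w ‼ b <0]
  χ-act-e {b} b<m with ∣‼∣-range1 b<m
  ... | P , P<m , ∣wb∣ = begin
    χ m (act w (e m b))            ≡⟨ cong (χ m) (act-e w b<m ∣wb∣) ⟩
    χ m (single m (sgn (w ‼ b)) P) ≡⟨ χ-single P<m (sgn-IsSign (w ‼ b) ∣wb∣) ⟩
    [ sgn (w ‼ b) <0]              ≡⟨ [sgn<0] (w ‼ b) ⟩
    [ w ‼ b <0]                    ∎
    where open ≡-Reasoning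

  χ-act-pair : ∀ {j b} → j < b → b < m →
    χ m (act w (e m b ⊖ e m j)) + χ m (act w (e m b ⊕ e m j)) ≡ pairInv (w ‼ j) (w ‼ b)
  χ-act-pair {j} {b} j<b b<m with ∣‼∣-range1 b<m | ∣‼∣-range1 (ℕP.<-trans j<b b<m)
  ... | P , P<m , ∣wb∣ | P' , P'<m , ∣wj∣ =
    trans (cong₂ _+_ (cong (χ m) (act-e⊖e w b<m j<m ∣wb∣ ∣wj∣)) (cong (χ m) (act-e⊕e w b<m j<m ∣wb∣ ∣wj∣)))
          (χ-double-pair (w ‼ b) (w ‼ j) ∣wb∣ ∣wj∣ P≢P' P<m P'<m)
    where
    j<m : j < m
    j<m = ℕP.<-trans j<b b<m
    P≢P' : P ≢ P'
    P≢P' P≡P' = ∣‼∣-injective j<b b<m (trans ∣wj∣ (trans (cong suc (sym P≡P')) (sym ∣wb∣)))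

  count-rootsAt : ∀ {b} → b < m → sum (map (χ m ∘ act w) (rootsAt m (suc b))) ≡ row w b
  count-rootsAt {b} b<m = cong₂ _+_ (χ-act-e b<m) (begin
    sum (map (χ m ∘ act w) (concatMap pairs (range1 b)))   ≡⟨ sum-map-concatMap (χ m ∘ act w) pairs (range1 b) ⟩
    sum (map (sum ∘ map (χ m ∘ act w) ∘ pairs) (range1 b)) ≡⟨ sum-map-range1 _ b ⟩
    ℕ∑.∑ b (λ j → χ m (act w (e m b ⊖ e m j)) + (χ m (act w (e m b ⊕ e m j)) + 0))
      ≡⟨ ℕ∑.∑-cong b (λ j j<b → trans (cong (χ m (act w (e m b ⊖ e m j)) +_) (ℕP.+-identityʳ _))
                                        (χ-act-pair j<b b<m)) ⟩
    ℕ∑.∑ b (λ j → pairInv (w ‼ j) (w ‼ b))                 ∎)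
    where
    open ≡-Reasoning
    pairs : ℕ → List (List ℤ)
    pairs j = (e m b ⊖ basis m j) ∷ (e m b ⊕ basis m j) ∷ []

  invᵢ≡row : ∀ {i} → i < m → invᵢ w (suc i) ≡ row w (m ∸ suc i)
  invᵢ≡row {i} i<m = begin
    invᵢ w (suc i)
      ≡⟨ cong (λ a → length (filter negRoot? (rootsAt m a))) (m∸i≡1+m∸1+i i<m) ⟩
    length (filter negRoot? (rootsAt m (suc (m ∸ suc i)))) ≡⟨ length-filter negRoot? _ ⟩
    sum (map (χ m ∘ act w) (rootsAt m (suc (m ∸ suc i)))) ≡⟨ count-rootsAt (m∸1+i<m i<m) ⟩
    row w (m ∸ suc i)                                   ∎
    where
    open ≡-Reasoning
    negRoot? : Decidable (λ r → act w r ∈ negRoots m)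
    negRoot? r = act w r ∈? negRoots m
    m∸i≡1+m∸1+i : ∀ {m i} → i < m → m ∸ i ≡ suc (m ∸ suc i)
    m∸i≡1+m∸1+i {suc m} (s≤s i≤m) = ℕP.+-∸-assoc 1 i≤m
    m∸1+i<m : ∀ {m i} → i < m → m ∸ suc i < m
    m∸1+i<m {suc m} {i} _ = s≤s (ℕP.m∸n≤m m i)

  inv≡invList : inv w ≡ invList w
  inv≡invList = begin
    inv w                               ≡⟨ sum-map-range1 (invᵢ w) m ⟩
    ℕ∑.∑ m (λ i → invᵢ w (suc i))       ≡⟨ ℕ∑.∑-cong m (λ i → invᵢ≡row) ⟩
    ℕ∑.∑ m (λ i → row w (m ∸ suc i))    ≡⟨ ℕ∑.∑-reverse m (row w) ⟩
    ℕ∑.∑ m (row w)                      ≡⟨ ∑-row≡invList w ⟩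
    invList w                           ∎
    where open ≡-Reasoning

-- Inserting ±n

insertAfter-↭ : ∀ i z xs → insertAfter i z xs ↭ z ∷ xs
insertAfter-↭ i z xs = ↭-trans (shift z (take i xs) (drop i xs)) (↭-reflexive (cong (z ∷_) (LP.take++drop≡id i xs)))

IsSignedPerm-insertAfter : ∀ i {z π} → ∣ z ∣ ≡ suc (length π) → IsSignedPerm π → IsSignedPerm (insertAfter i z π)
IsSignedPerm-insertAfter i {z} {π} ∣z∣ σ =
  subst (λ n → map ∣_∣ (insertAfter i z π) ↭ range1 n) (sym (↭-length (insertAfter-↭ i z π)))
    (↭-trans (↭-map⁺ ∣_∣ (insertAfter-↭ i z π))
    (↭-trans (prep ∣ z ∣ σ)
    (subst (λ l → l ∷ range1 L ↭ range1 (suc L)) (sym ∣z∣)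
    (↭-trans (∷↭∷ʳ (suc L) (range1 L)) (↭-reflexive range1-∷ʳ)))))
  where
  L : ℕ
  L = length π
  range1-∷ʳ : range1 L ∷ʳ suc L ≡ range1 (suc L)
  range1-∷ʳ = trans (cong (_∷ʳ suc L) (range1-applyUpTo L))
                    (trans (LP.applyUpTo-∷ʳ suc L) (sym (range1-applyUpTo (suc L))))

sum-pairInv-larger : ∀ z ys → All (λ y → ∣ y ∣ < ∣ z ∣) ys → sum (map (pairInv z) ys) ≡ length ys
sum-pairInv-larger z []       []           = refl
sum-pairInv-larger z (y ∷ ys) (y<z ∷ ys<z) = cong₂ _+_ (pairInv-> {z} {y} y<z) (sum-pairInv-larger z ys ys<z)

invList-insertAfter : ∀ {z} i π → All (λ y → ∣ y ∣ < ∣ z ∣) π → i ≤ length π →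
  invList (insertAfter i z π) ≡ invList π + (length π ∸ i) + (1 + 2 * i) * [ z <0]
invList-insertAfter {z} zero π π<z _ = begin
  [ z <0] + sum (map (pairInv z) π) + invList π ≡⟨ cong (λ n → [ z <0] + n + invList π) (sum-pairInv-larger z π π<z) ⟩
  [ z <0] + length π + invList π               ≡⟨ rearrange [ z <0] (length π) (invList π) ⟩
  invList π + length π + 1 * [ z <0]           ∎
  where
  open ≡-Reasoning
  rearrange : ∀ a l I → a + l + I ≡ I + l + 1 * a
  rearrange = solve-∀
invList-insertAfter {z} (suc i) (x ∷ π) (x<z ∷ π<z) (s≤s i≤n) = begin
  [ x <0] + sum (map (pairInv x) (insertAfter i z π)) + invList (insertAfter i z π)
    ≡⟨ cong₂ (λ s I → [ x <0] + s + I)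
             (trans (sum-map-insertAfter (pairInv x)) (cong (_+ sum (map (pairInv x) π)) (pairInv-< {x} {z} x<z)))
             (invList-insertAfter {z} i π π<z i≤n) ⟩
  [ x <0] + (2 * [ z <0] + sum (map (pairInv x) π)) + (invList π + (length π ∸ i) + (1 + 2 * i) * [ z <0])
    ≡⟨ rearrange [ x <0] [ z <0] (sum (map (pairInv x) π)) (invList π) (length π ∸ i) i ⟩
  [ x <0] + sum (map (pairInv x) π) + invList π + (length π ∸ i) + (1 + 2 * suc i) * [ z <0] ∎
  where
  open ≡-Reasoning
  sum-map-insertAfter : ∀ f → sum (map f (insertAfter i z π)) ≡ f z + sum (map f π)
  sum-map-insertAfter f = sum-↭ (↭-map⁺ f (insertAfter-↭ i z π))
  rearrange : ∀ a c s I l i → a + (2 * c + s) + (I + l + (1 + 2 * i) * c) ≡ a + s + I + l + (1 + 2 * suc i) * c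
  rearrange = solve-∀

inv-insertAfter : ∀ i {z π} → IsSignedPerm π → ∣ z ∣ ≡ suc (length π) → i ≤ length π →
  inv (insertAfter i z π) ≡ inv π + (length π ∸ i) + (1 + 2 * i) * [ z <0]
inv-insertAfter i {z} {π} σ ∣z∣ i≤n = begin
  inv (insertAfter i z π)     ≡⟨ SignedPerm.inv≡invList (IsSignedPerm-insertAfter i ∣z∣ σ) ⟩
  invList (insertAfter i z π) ≡⟨ invList-insertAfter i π π<z i≤n ⟩
  invList π + (length π ∸ i) + (1 + 2 * i) * [ z <0]
    ≡⟨ cong (λ I → I + (length π ∸ i) + (1 + 2 * i) * [ z <0]) (SignedPerm.inv≡invList σ) ⟨
  inv π + (length π ∸ i) + (1 + 2 * i) * [ z <0] ∎
  where
  open ≡-Reasoning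
  π<z : All (λ y → ∣ y ∣ < ∣ z ∣) π
  π<z = subst (λ n → All (λ y → ∣ y ∣ < n) π) (sym ∣z∣) (SignedPerm.∣entries∣<1+m σ)

inv-insertAfter-max : ∀ i {π} → IsSignedPerm π → i ≤ length π →
  inv (insertAfter i +[1+ length π ] π) ≡ inv π + (length π ∸ i)
inv-insertAfter-max i {π} σ i≤n = begin
  inv (insertAfter i +[1+ length π ] π)    ≡⟨ inv-insertAfter i σ refl i≤n ⟩
  inv π + (length π ∸ i) + (1 + 2 * i) * 0 ≡⟨ cong (inv π + (length π ∸ i) +_) (ℕP.*-zeroʳ (1 + 2 * i)) ⟩
  inv π + (length π ∸ i) + 0               ≡⟨ ℕP.+-identityʳ _ ⟩
  inv π + (length π ∸ i)                   ∎
  where open ≡-Reasoning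

inv-insertAfter-min : ∀ i {π} → IsSignedPerm π → i ≤ length π →
  inv (insertAfter i -[1+ length π ] π) ≡ inv π + (suc (length π) + i)
inv-insertAfter-min i {π} σ i≤n = begin
  inv (insertAfter i -[1+ length π ] π)            ≡⟨ inv-insertAfter i σ refl i≤n ⟩
  inv π + (length π ∸ i) + (1 + 2 * i) * 1         ≡⟨ rearrange (inv π) (length π ∸ i) i ⟩
  inv π + (suc ((length π ∸ i) + i) + i)           ≡⟨ cong (λ l → inv π + (suc l + i)) (ℕP.m∸n+n≡m i≤n) ⟩
  inv π + (suc (length π) + i)                     ∎
  where
  open ≡-Reasoning
  rearrange : ∀ I d i → I + d + (1 + 2 * i) * 1 ≡ I + (suc (d + i) + i)
  rearrange = solve-∀

open import Data.Integer using (+_)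

mainTheorem6 : {c ℓ : Level} (R : CommutativeSemiring c ℓ) (n : ℕ) → 2 ≤ n →
    (π : List ℤ) → length π ≡ n ∸ 1 → IsSignedPerm π →
    (q : CommutativeSemiring.Carrier R) →
    (CommutativeSemiring._≈_ R
       (sumR R (map (λ i → pow R q (inv (insertAfter i (+ n) π))) (upTo n)))
       (CommutativeSemiring._*_ R (qint R n q) (pow R q (inv π))))
    ×
    (CommutativeSemiring._≈_ R
       (sumR R (map (λ i → pow R q (inv (insertAfter i (- (+ n)) π))) (upTo n)))
       (CommutativeSemiring._*_ R (CommutativeSemiring._*_ R (pow R q n) (qint R n q)) (pow R q (inv π))))
mainTheorem6 R (suc _) _ π refl σ q =
  ≈-trans (sumR-pow-cong n (λ i i<n → inv-insertAfter-max i σ (ℕP.≤-pred i<n))) (∑-pow-descending n (inv π)) ,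
  ≈-trans (sumR-pow-cong n (λ i i<n → inv-insertAfter-min i σ (ℕP.≤-pred i<n))) (∑-pow-ascending n (inv π))
  where
  open CommutativeSemiring R using () renaming (trans to ≈-trans)
  open QSum R q
  n : ℕ
  n = suc (length π)
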